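{- Let $n\ge1$, $\mathcal{M}=\{1^{k_1},\ldots,n^{k_n}\}$ with all $k_i\ge1$, and let $m\ge0$ be an integer. There is a bijection $\psi:\mathcal{BT}_{\mathcal{M},m}\to\mathcal{T}^*_{\mathcal{M},m}$.
   Context: $\mathcal{M}$ is the multiset in which $i$ occurs exactly $k_i$ times. An ordered tree is a rooted tree whose children at each vertex are linearly ordered left to right; the level of a vertex is its distance from the root. Vertices compare by their labels. $\mathcal{T}_{\mathcal{M}}$: ordered trees with vertices labeled by the multiset $\{0\}\cup\mathcal{M}$ (each label used exactly as often as its multiplicity), root labeled $0$, and each odd-level vertex labeled $i$ having exactly $k_i-1$ children, all labeled $i$. A half-edge is an edge whose lower endpoint is an unlabeled leaf. $\mathcal{T}^*_{\mathcal{M},m}$ is the set of trees obtained from some $T\in\mathcal{T}_{\mathcal{M}}$ by attaching, in total, $m$ half-edges to vertices at even level of $T$ (interleaved among their children), such that for each even-level vertex $u$: (1) the half-edges at $u$, viewed as walls, divide the labeled children of $u$ into (possibly empty) compartments, and within each compartment the labeled children increase from left to right; (2) if the last labeled child $v$ of $u$ satisfies $v>u$, some half-edge lies to the right of $v$; (3) if the first labeled child $v$ of $u$ satisfies $u>v$, some half-edge lies to the left of $v$. $\mathcal{BT}_{\mathcal{M},m}$ is the set of ordered trees such that: (i) vertices are labeled by the multiset $\{0\}\cup\mathcal{M}$ (each label used exactly as often as its multiplicity), except that some leaves at odd level may be unlabeled; (ii) the root is labeled $0$; (iii) each labeled odd-level vertex with label $i$ has exactly $k_i-1$ children, all labeled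 $i$; (iv) for each internal vertex $v$ at even level, the sequence of children of $v$ is divided into consecutive blocks, each block being either a single unlabeled leaf or a nonempty set of labeled children increasing from left to right; and the total number of blocks (over all even-level internal vertices) is $m$. -}

module Defs where

open import Data.Nat using (ℕ; zero; suc; _+_; _∸_; _≡ᵇ_; _<ᵇ_; _≤ᵇ_)
open import Data.Bool using (Bool; true; false; _∧_; _∨_; not; if_then_else_; T)
open import Data.List using (List; []; _∷_; reverse; length; _++_; upTo; head; last)
open import Data.List.NonEmpty using (List⁺; _∷_)
open import Data.Maybe using (Maybe; just; nothing)
open import Data.Vec using (Vec) renaming ([] to []ᵛ; _∷_ to _∷ᵛ_)
open import Data.Product using (Σ)

-- Vertices carry natural-number labels; the only unlabeled vertices are
-- leaves at odd level (constructor `half`).  The root is an EvenTree.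
-- (Both T*_{M,m} and BT_{M,m} only allow unlabeled vertices as odd-level
-- leaves, so this loses nothing.)

mutual
  data EvenTree : Set where
    ev : ℕ → List OddTree → EvenTree
  data OddTree : Set where
    half : OddTree                            -- unlabeled leaf (lower end of a half-edge)
    od   : ℕ → List EvenTree → OddTree

lookupℕ : {n : ℕ} → Vec ℕ n → ℕ → ℕ
lookupℕ []ᵛ _ = 0
lookupℕ (x ∷ᵛ xs) zero = x
lookupℕ (x ∷ᵛ xs) (suc i) = lookupℕ xs i

-- multiplicity of label ℓ in {0} ∪ M  (label i ≥ 1 is k_i, labels > n absent)
mult : {n : ℕ} → Vec ℕ n → ℕ → ℕ
mult k zero = 1
mult k (suc i) = lookupℕ k i

countL : ℕ → List ℕ → ℕ
countL ℓ [] = 0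
countL ℓ (x ∷ xs) = (if x ≡ᵇ ℓ then 1 else 0) + countL ℓ xs

all : {A : Set} → (A → Bool) → List A → Bool
all p [] = true
all p (x ∷ xs) = p x ∧ all p xs

isMultiset : {n : ℕ} → Vec ℕ n → List ℕ → Bool
isMultiset {n} k xs = all (λ x → x ≤ᵇ n) xs ∧ all (λ ℓ → countL ℓ xs ≡ᵇ mult k ℓ) (upTo (suc n))

incr : List ℕ → Bool
incr [] = true
incr (x ∷ []) = true
incr (x ∷ y ∷ r) = (x <ᵇ y) ∧ incr (y ∷ r)

mutual
  labelsE : EvenTree → List ℕ
  labelsE (ev a cs) = a ∷ labelsOs cs

  labelsOs : List OddTree → List ℕ
  labelsOs [] = []
  labelsOs (c ∷ cs) = labelsO c ++ labelsOs cs

  labelsO : OddTree → List ℕ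
  labelsO half = []
  labelsO (od a es) = a ∷ labelsEs es

  labelsEs : List EvenTree → List ℕ
  labelsEs [] = []
  labelsEs (e ∷ es) = labelsE e ++ labelsEs es

mutual
  halvesE : EvenTree → ℕ
  halvesE (ev a cs) = halvesOs cs

  halvesOs : List OddTree → ℕ
  halvesOs [] = 0
  halvesOs (half ∷ cs) = suc (halvesOs cs)
  halvesOs (od a es ∷ cs) = halvesEs es + halvesOs cs

  halvesEs : List EvenTree → ℕ
  halvesEs [] = 0
  halvesEs (e ∷ es) = halvesE e + halvesEs es

rootLabelE : EvenTree → ℕ
rootLabelE (ev a _) = a

labeledChildren : List OddTree → List ℕ
labeledChildren [] = []
labeledChildren (half ∷ cs) = labeledChildren cs
labeledChildren (od a _ ∷ cs) = a ∷ labeledChildren cs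

compartments : List OddTree → List (List ℕ)
compartments [] = [] ∷ []
compartments (half ∷ cs) = [] ∷ compartments cs
compartments (od a _ ∷ cs) with compartments cs
... | c ∷ r = (a ∷ c) ∷ r
... | [] = (a ∷ []) ∷ []

halfBeforeFirstLabeled : List OddTree → Bool
halfBeforeFirstLabeled [] = false
halfBeforeFirstLabeled (half ∷ _) = true
halfBeforeFirstLabeled (od _ _ ∷ _) = false

cond1 : List OddTree → Bool
cond1 cs = all incr (compartments cs)

cond2 : ℕ → List OddTree → Bool
cond2 u cs with last (labeledChildren cs)
... | nothing = true
... | just v = not (u <ᵇ v) ∨ halfBeforeFirstLabeled (reverse cs)   -- half-edge right of v

cond3 : ℕ → List OddTree → Bool
cond3 u cs with head (labeledChildren cs)
... | nothing = true
... | just v = not (v <ᵇ u) ∨ halfBeforeFirstLabeled cs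

mutual
  starOkE : {n : ℕ} → Vec ℕ n → EvenTree → Bool
  starOkE k (ev u cs) = cond1 cs ∧ cond2 u cs ∧ cond3 u cs ∧ starOkOs k cs

  starOkOs : {n : ℕ} → Vec ℕ n → List OddTree → Bool
  starOkOs k [] = true
  starOkOs k (half ∷ cs) = starOkOs k cs
  starOkOs k (od i es ∷ cs) =
    (length es ≡ᵇ (mult k i ∸ 1)) ∧ all (λ e → rootLabelE e ≡ᵇ i) es
      ∧ starOkEs k es ∧ starOkOs k cs

  starOkEs : {n : ℕ} → Vec ℕ n → List EvenTree → Bool
  starOkEs k [] = true
  starOkEs k (e ∷ es) = starOkE k e ∧ starOkEs k es

isTStar : {n : ℕ} → Vec ℕ n → ℕ → EvenTree → Bool
isTStar k m t = (rootLabelE t ≡ᵇ 0) ∧ isMultiset k (labelsE t)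
                ∧ (halvesE t ≡ᵇ m) ∧ starOkE k t

TStar : {n : ℕ} → Vec ℕ n → ℕ → Set
TStar k m = Σ EvenTree (λ t → T (isTStar k m t))

-- Trees of BT_{M,m}: the children of each even-level vertex are given as
-- a sequence of blocks (the division into blocks is part of the data);
-- a block is a single unlabeled leaf or a nonempty list of labeled children.

mutual
  data BEven : Set where
    bev : ℕ → List Block → BEven
  data Block : Set where
    hblock : Block
    lblock : List⁺ BOdd → Block
  data BOdd : Set where
    bod : ℕ → List BEven → BOdd

mutual
  labelsBE : BEven → List ℕ
  labelsBE (bev a bs) = a ∷ labelsBs bs

  labelsBs : List Block → List ℕ
  labelsBs [] = []
  labelsBs (hblock ∷ bs) = labelsBs bs
  labelsBs (lblock (o ∷ os) ∷ bs) = labelsBO o ++ (labelsBOs os ++ labelsBs bs)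

  labelsBOs : List BOdd → List ℕ
  labelsBOs [] = []
  labelsBOs (o ∷ os) = labelsBO o ++ labelsBOs os

  labelsBO : BOdd → List ℕ
  labelsBO (bod a es) = a ∷ labelsBEs es

  labelsBEs : List BEven → List ℕ
  labelsBEs [] = []
  labelsBEs (e ∷ es) = labelsBE e ++ labelsBEs es

mutual
  blocksBE : BEven → ℕ
  blocksBE (bev a bs) = length bs + blocksBs bs

  blocksBs : List Block → ℕ
  blocksBs [] = 0
  blocksBs (hblock ∷ bs) = blocksBs bs
  blocksBs (lblock (o ∷ os) ∷ bs) = blocksBO o + (blocksBOs os + blocksBs bs)

  blocksBOs : List BOdd → ℕ
  blocksBOs [] = 0
  blocksBOs (o ∷ os) = blocksBO o + blocksBOs os

  blocksBO : BOdd → ℕ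
  blocksBO (bod a es) = blocksBEs es

  blocksBEs : List BEven → ℕ
  blocksBEs [] = 0
  blocksBEs (e ∷ es) = blocksBE e + blocksBEs es

rootLabelBE : BEven → ℕ
rootLabelBE (bev a _) = a

labelBO : BOdd → ℕ
labelBO (bod a _) = a

mutual
  btOkE : {n : ℕ} → Vec ℕ n → BEven → Bool
  btOkE k (bev a bs) = btOkBs k bs

  btOkBs : {n : ℕ} → Vec ℕ n → List Block → Bool
  btOkBs k [] = true
  btOkBs k (hblock ∷ bs) = btOkBs k bs
  btOkBs k (lblock (o ∷ os) ∷ bs) =
    incr (labelBO o ∷ labelsOfBOs os) ∧ btOkO k o ∧ btOkOs k os ∧ btOkBs k bs

  labelsOfBOs : List BOdd → List ℕ
  labelsOfBOs [] = []
  labelsOfBOs (o ∷ os) = labelBO o ∷ labelsOfBOs os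

  btOkOs : {n : ℕ} → Vec ℕ n → List BOdd → Bool
  btOkOs k [] = true
  btOkOs k (o ∷ os) = btOkO k o ∧ btOkOs k os

  btOkO : {n : ℕ} → Vec ℕ n → BOdd → Bool
  btOkO k (bod i es) =
    (length es ≡ᵇ (mult k i ∸ 1)) ∧ all (λ e → rootLabelBE e ≡ᵇ i) es ∧ btOkEs k es

  btOkEs : {n : ℕ} → Vec ℕ n → List BEven → Bool
  btOkEs k [] = true
  btOkEs k (e ∷ es) = btOkE k e ∧ btOkEs k es

isBT : {n : ℕ} → Vec ℕ n → ℕ → BEven → Bool
isBT k m t = (rootLabelBE t ≡ᵇ 0) ∧ isMultiset k (labelsBE t)
             ∧ (blocksBE t ≡ᵇ m) ∧ btOkE k t

BT : {n : ℕ} → Vec ℕ n → ℕ → Set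
BT k m = Σ BEven (λ t → T (isBT k m t))

module Submission where

-- At an even vertex u the two families only differ in how the children of u are
-- arranged.  A block of a BT-tree is an increasing list R = L ++ H with L ≤ u < H.
-- ψ turns the blocks R₁ … Rₘ of u into the children H₁ | L₁H₂ | L₂H₃ | … | Lₘ, the
-- m bars being half-edges: every compartment is increasing, the first one starts
-- above u and the last one ends at or below u, which are conditions (1)–(3).
-- Conversely Rⱼ is the part ≤ u of the j-th compartment followed by the part > u of
-- the previous one.  Both maps act recursively on subtrees and preserve the labels
-- and the count of blocks = half-edges.  Inverting ψ needs the first child of u to
-- carry a label different from u; in a T*-tree no child repeats its parent's label,
-- since the kᵢ copies of i are used up by an odd vertex i and its kᵢ − 1 children,
-- and 0 occurs only at the root.

open import Data.Bool using (Bool; true; false; T; not; _∨_; _∧_; if_then_else_)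
open import Data.Bool.Properties using (T-∧; T-≡; T-irrelevant; ∨-zeroʳ; ∨-identityʳ)
open import Data.Empty using (⊥-elim)
open import Data.Fin using (Fin)
open import Data.List
  using (List; []; _∷_; _++_; map; concat; concatMap; length; takeWhile; dropWhile; catMaybes; head; last;
         initLast; _∷ʳ′_; upTo)
open import Data.List.Properties
  using (++-identityʳ; ++-assoc; takeWhile++dropWhile; map-++; map-∘; last-map; reverse-++;
         concatMap-++)
open import Data.List.Membership.Propositional.Properties using (∈-upTo⁺)
open import Data.List.NonEmpty as List⁺ using (List⁺; _∷_; _∷⁺_; toList)
open import Data.List.Relation.Binary.Permutation.Propositional
  using (_↭_; ↭-refl; ↭-sym; ↭-trans; prep; swap; module PermutationReasoning)
  renaming (refl to ↭-≡; trans to ↭-trans′)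
open import Data.List.Relation.Binary.Permutation.Propositional.Properties
  using (++⁺ˡ; ++⁺; shifts; All-resp-↭; map⁺)
open import Data.List.Relation.Unary.All as All using (All; []; _∷_)
open import Data.List.Relation.Unary.All.Properties as All using (all-head-dropWhile; last⁺)
open import Data.List.Relation.Unary.AllPairs as AllPairs using (AllPairs; []; _∷_)
import Data.List.Relation.Unary.AllPairs.Properties as AllPairs
open import Data.List.Relation.Unary.Linked using (Linked; []; [-]; _∷_)
open import Data.List.Relation.Unary.Linked.Properties using (Linked⇒AllPairs; AllPairs⇒Linked)
open import Data.Maybe.Base using (Maybe; just; nothing; _>>=_) renaming (map to maybeMap)
import Data.Maybe.Relation.Unary.All as Maybe
import Data.Maybe.Relation.Unary.All.Properties as Maybe
open import Data.Nat using (ℕ; suc; _+_; _∸_; _≤_; _<_; _≤?_; _<ᵇ_; _≡ᵇ_; _≤ᵇ_; s≤s; z≤n)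
open import Data.Nat.ListAction using (sum)
open import Data.Nat.ListAction.Properties using (sum-++; sum-↭)
open import Data.Nat.Properties
  using (<-trans; ≤-<-trans; <-≤-trans; <⇒≤; ≰⇒>; <ᵇ⇒<; <⇒<ᵇ; ≤∧≢⇒<; <⇒≱; ≮⇒≥; ≤-trans; ≤-pred;
         ≤-reflexive; ≤ᵇ⇒≤; ≡ᵇ⇒≡; ≡⇒≡ᵇ; n≤0⇒n≡0; m+n≡0⇒m≡0; m+n≡0⇒n≡0; m≤n+m; m+n≤o⇒m≤o;
         m+n≤o⇒n≤o; ∸-monoˡ-≤; +-monoˡ-≤; +-monoʳ-≤; +-cancelʳ-≤; +-comm; +-assoc; +-suc)
open import Data.Product using (Σ; _×_; _,_; proj₁; proj₂)
open import Data.Unit using (⊤)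
open import Data.Vec using (Vec; lookup)
open import Function.Base using (_∘_; id)
open import Function.Bundles using (_⇔_; mk⇔; Equivalence; _⤖_; mk↔ₛ′)
import Function.Properties.Equivalence as ⇔
open import Function.Properties.Inverse using (↔⇒⤖)
open import Level using (Level)
open import Relation.Binary.PropositionalEquality
open import Relation.Nullary using (does; yes; no; contradiction)
open import Relation.Unary using (Pred; Decidable; ∁)

open import Defs

open Equivalence using (to; from)

private
  variable
    ℓ : Level
    A B : Set

module _ {P : Pred A ℓ} (P? : Decidable P) where

  takeWhile-++ : ∀ {xs} ys → All P xs → takeWhile P? (xs ++ ys) ≡ xs ++ takeWhile P? ys
  takeWhile-++ ys [] = refl
  takeWhile-++ {x ∷ xs} ys (px ∷ pxs) with P? x
  ... | yes _ = cong (x ∷_) (takeWhile-++ ys pxs)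
  ... | no ¬px = contradiction px ¬px

  dropWhile-++ : ∀ {xs} ys → All P xs → dropWhile P? (xs ++ ys) ≡ dropWhile P? ys
  dropWhile-++ ys [] = refl
  dropWhile-++ {x ∷ xs} ys (px ∷ pxs) with P? x
  ... | yes _ = dropWhile-++ ys pxs
  ... | no ¬px = contradiction px ¬px

  takeWhile-all : ∀ {xs} → All P xs → takeWhile P? xs ≡ xs
  takeWhile-all {xs} pxs = begin
    takeWhile P? xs         ≡⟨ cong (takeWhile P?) (sym (++-identityʳ xs)) ⟩
    takeWhile P? (xs ++ []) ≡⟨ takeWhile-++ [] pxs ⟩
    xs ++ []                ≡⟨ ++-identityʳ xs ⟩
    xs                      ∎
    where open ≡-Reasoning

  All-takeWhile : ∀ xs → All P (takeWhile P? xs)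
  All-takeWhile [] = []
  All-takeWhile (x ∷ xs) with P? x
  ... | yes px = px ∷ All-takeWhile xs
  ... | no _ = []

  takeWhile-∁head : ∀ {xs} → Maybe.All (∁ P) (head xs) → takeWhile P? xs ≡ []
  takeWhile-∁head {[]} _ = refl
  takeWhile-∁head {x ∷ xs} (Maybe.just ¬px) with P? x
  ... | yes px = contradiction px ¬px
  ... | no _ = refl

  dropWhile-∁head : ∀ {xs} → Maybe.All (∁ P) (head xs) → dropWhile P? xs ≡ xs
  dropWhile-∁head {[]} _ = refl
  dropWhile-∁head {x ∷ xs} (Maybe.just ¬px) with P? x
  ... | yes px = contradiction px ¬px
  ... | no _ = refl

  takeWhile-dropWhile : ∀ xs → takeWhile P? (dropWhile P? xs) ≡ []
  takeWhile-dropWhile xs = takeWhile-∁head (all-head-dropWhile P? xs)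

  dropWhile-idem : ∀ xs → dropWhile P? (dropWhile P? xs) ≡ dropWhile P? xs
  dropWhile-idem xs = dropWhile-∁head (all-head-dropWhile P? xs)

module _ {P : Pred A ℓ} (P? : Decidable P) where

  takeWhile⁺ : ∀ {ℓ′} {Q : Pred A ℓ′} {xs} → All Q xs → All Q (takeWhile P? xs)
  takeWhile⁺ [] = []
  takeWhile⁺ {xs = x ∷ xs} (qx ∷ qxs) with does (P? x)
  ... | true = qx ∷ takeWhile⁺ qxs
  ... | false = []

  AllPairs-takeWhile : ∀ {ℓ′} {R : A → A → Set ℓ′} {xs} → AllPairs R xs → AllPairs R (takeWhile P? xs)
  AllPairs-takeWhile [] = []
  AllPairs-takeWhile {xs = x ∷ xs} (rx ∷ rxs) with does (P? x)
  ... | true = takeWhile⁺ rx ∷ AllPairs-takeWhile rxs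
  ... | false = []

  AllPairs-dropWhile : ∀ {ℓ′} {R : A → A → Set ℓ′} {xs} → AllPairs R xs → AllPairs R (dropWhile P? xs)
  AllPairs-dropWhile [] = []
  AllPairs-dropWhile {xs = x ∷ xs} (rx ∷ rxs) with does (P? x)
  ... | true = AllPairs-dropWhile rxs
  ... | false = rx ∷ rxs

module _ (f : A → B) {P : Pred B ℓ} (P? : Decidable P) {Q : Pred A ℓ} (Q? : Decidable Q)
         (agree : ∀ x → does (P? (f x)) ≡ does (Q? x)) where

  takeWhile-map : ∀ xs → takeWhile P? (map f xs) ≡ map f (takeWhile Q? xs)
  takeWhile-map [] = refl
  takeWhile-map (x ∷ xs) rewrite agree x with does (Q? x)
  ... | true = cong (f x ∷_) (takeWhile-map xs)
  ... | false = refl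

  dropWhile-map : ∀ xs → dropWhile P? (map f xs) ≡ map f (dropWhile Q? xs)
  dropWhile-map [] = refl
  dropWhile-map (x ∷ xs) rewrite agree x with does (Q? x)
  ... | true = dropWhile-map xs
  ... | false = refl

last-++-∷ : ∀ (xs : List A) y ys → last (xs ++ y ∷ ys) ≡ last (y ∷ ys)
last-++-∷ [] y ys = refl
last-++-∷ (x ∷ []) y ys = refl
last-++-∷ (x ∷ x′ ∷ xs) y ys = last-++-∷ (x′ ∷ xs) y ys

bind-last⁺ : ∀ {P : Pred A ℓ} {m} → Maybe.All (All P) m → Maybe.All P (m >>= last)
bind-last⁺ (Maybe.just allP) = last⁺ allP
bind-last⁺ Maybe.nothing = Maybe.nothing

head-map⁻ : ∀ {P : Pred B ℓ} {f : A → B} xs → Maybe.All P (head (map f xs)) → Maybe.All (P ∘ f) (head xs)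
head-map⁻ [] _ = Maybe.nothing
head-map⁻ (x ∷ xs) (Maybe.just px) = Maybe.just px

last-map⁻ : ∀ {P : Pred B ℓ} {f : A → B} Xs → Maybe.All (All P) (last (map (map f) Xs)) → Maybe.All (All (P ∘ f)) (last Xs)
last-map⁻ {f = f} Xs allP =
  Maybe.map All.map⁻ (Maybe.map⁻ (subst (Maybe.All (All _)) (last-map (map f) Xs) allP))

concat-↭ : {xss yss : List (List A)} → xss ↭ yss → concat xss ↭ concat yss
concat-↭ ↭-≡ = ↭-refl
concat-↭ (prep xs p) = ++⁺ˡ xs (concat-↭ p)
concat-↭ (swap xs ys p) = ↭-trans (++⁺ˡ xs (++⁺ˡ ys (concat-↭ p))) (shifts xs ys)
concat-↭ (↭-trans′ p q) = ↭-trans (concat-↭ p) (concat-↭ q)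

Σ-T-≡ : ∀ {p : A → Bool} {a b} {pa : T (p a)} {pb : T (p b)} → a ≡ b → _≡_ {A = Σ A (T ∘ p)} (a , pa) (b , pb)
Σ-T-≡ refl = cong (_ ,_) (T-irrelevant _ _)

T-all⇔ : ∀ (p : A → Bool) {xs} → T (all p xs) ⇔ All (T ∘ p) xs
T-all⇔ p = mk⇔ (split-all _) (join-all _)
  where
  split-all : ∀ xs → T (all p xs) → All (T ∘ p) xs
  split-all [] _ = []
  split-all (x ∷ xs) t = proj₁ (T-∧ {p x} .to t) ∷ split-all xs (proj₂ (T-∧ {p x} .to t))
  join-all : ∀ xs → All (T ∘ p) xs → T (all p xs)
  join-all [] [] = _
  join-all (x ∷ xs) (px ∷ pxs) = T-∧ .from (px , join-all xs pxs)

T-∧₄ : ∀ a b c {d} → T (a ∧ b ∧ c ∧ d) ⇔ (T a × T b × T c × T d)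
T-∧₄ a b c {d} = mk⇔ split₄ join₄
  where
  split₄ : T (a ∧ b ∧ c ∧ d) → T a × T b × T c × T d
  split₄ t with T-∧ {a} .to t
  ... | ta , t′ with T-∧ {b} .to t′
  ... | tb , t″ with T-∧ {c} .to t″
  ... | tc , td = ta , tb , tc , td
  join₄ : T a × T b × T c × T d → T (a ∧ b ∧ c ∧ d)
  join₄ (ta , tb , tc , td) = T-∧ .from (ta , T-∧ .from (tb , T-∧ .from (tc , td)))

T-not-<ᵇ-∨-false : ∀ m n → T (not (m <ᵇ n) ∨ false) ⇔ n ≤ m
T-not-<ᵇ-∨-false m n rewrite ∨-identityʳ (not (m <ᵇ n)) = mk⇔ ≥-of ≥-to
  where
  ≥-of : T (not (m <ᵇ n)) → n ≤ m
  ≥-of t = ≮⇒≥ (λ m<n → subst (T ∘ not) (T-≡ .to (<⇒<ᵇ m<n)) t)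
  ≥-to : n ≤ m → T (not (m <ᵇ n))
  ≥-to n≤m with m <ᵇ n in eq
  ... | true = <⇒≱ (<ᵇ⇒< m n (subst T (sym eq) _)) n≤m
  ... | false = _

-- In a word `nothing` is a wall (a half-edge); the compartments of a word are the
-- runs of letters between consecutive walls.

flatten : List⁺ (List A) → List (Maybe A)
flatten (C ∷ Cs) = map just C ++ concatMap (λ D → nothing ∷ map just D) Cs

split : List (Maybe A) → List⁺ (List A)
split [] = [] ∷ []
split (nothing ∷ w) = [] ∷⁺ split w
split (just x ∷ w) = (x ∷ List⁺.head (split w)) ∷ List⁺.tail (split w)

walls : List (Maybe A) → ℕ
walls [] = 0
walls (nothing ∷ w) = suc (walls w)
walls (just _ ∷ w) = walls w

split-++ : ∀ C (w : List (Maybe A)) →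
           split (map just C ++ w) ≡ (C ++ List⁺.head (split w)) ∷ List⁺.tail (split w)
split-++ [] w = refl
split-++ (x ∷ C) w rewrite split-++ C w = refl

split-flatten : ∀ (C : List A) Cs → split (flatten (C ∷ Cs)) ≡ C ∷ Cs
split-flatten C [] = trans (split-++ C []) (cong (_∷ []) (++-identityʳ C))
split-flatten C (D ∷ Ds) rewrite split-++ C (nothing ∷ flatten (D ∷ Ds)) | split-flatten D Ds =
  cong (_∷ D ∷ Ds) (++-identityʳ C)

flatten-∷ : ∀ (x : A) C Cs → flatten ((x ∷ C) ∷ Cs) ≡ just x ∷ flatten (C ∷ Cs)
flatten-∷ x C [] = refl
flatten-∷ x C (D ∷ Ds) = refl

flatten-split : (w : List (Maybe A)) → flatten (split w) ≡ w
flatten-split [] = refl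
flatten-split (nothing ∷ w) = cong (nothing ∷_) (flatten-split w)
flatten-split (just x ∷ w) =
  trans (flatten-∷ x (List⁺.head (split w)) (List⁺.tail (split w))) (cong (just x ∷_) (flatten-split w))

map-maybeMap-just : (f : A → B) (C : List A) → map (maybeMap f) (map just C) ≡ map just (map f C)
map-maybeMap-just f C = trans (sym (map-∘ C)) (map-∘ C)

flatten-map : (f : A → B) (C : List A) (Cs : List (List A)) →
              map (maybeMap f) (flatten (C ∷ Cs)) ≡ flatten (List⁺.map (map f) (C ∷ Cs))
flatten-map f C [] =
  trans (map-++ (maybeMap f) (map just C) []) (cong (_++ []) (map-maybeMap-just f C))
flatten-map f C (D ∷ Ds) =
  trans (map-++ (maybeMap f) (map just C) _)
        (cong₂ (λ xs ys → xs ++ nothing ∷ ys) (map-maybeMap-just f C) (flatten-map f D Ds))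

split-map : (f : A → B) (w : List (Maybe A)) → split (map (maybeMap f) w) ≡ List⁺.map (map f) (split w)
split-map f w = begin
  split (map (maybeMap f) w)                   ≡⟨ cong (split ∘ map (maybeMap f)) (sym (flatten-split w)) ⟩
  split (map (maybeMap f) (flatten (split w))) ≡⟨ cong split (flatten-map f (List⁺.head (split w)) (List⁺.tail (split w))) ⟩
  split (flatten (List⁺.map (map f) (split w))) ≡⟨ split-flatten _ _ ⟩
  List⁺.map (map f) (split w)                   ∎
  where open ≡-Reasoning

-- For a word w, last w >>= id is its last letter unless that letter is a wall.
last-flatten : ∀ (C : List A) Cs → (last (flatten (C ∷ Cs)) >>= id) ≡ (last (C ∷ Cs) >>= last)
last-flatten C [] = begin
  (last (map just C ++ []) >>= id) ≡⟨ cong (λ w → last w >>= id) (++-identityʳ (map just C)) ⟩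
  (last (map just C) >>= id)       ≡⟨ cong (_>>= id) (last-map just C) ⟩
  (maybeMap just (last C) >>= id)  ≡⟨ unjust (last C) ⟩
  last C                           ∎
  where
  open ≡-Reasoning
  unjust : (m : Maybe A) → (maybeMap just m >>= id) ≡ m
  unjust (just x) = refl
  unjust nothing = refl
last-flatten C (D ∷ Ds) = begin
  (last (map just C ++ nothing ∷ flatten (D ∷ Ds)) >>= id) ≡⟨ cong (_>>= id) (last-++-∷ (map just C) nothing _) ⟩
  (last (nothing ∷ flatten (D ∷ Ds)) >>= id)               ≡⟨ skipWall (flatten (D ∷ Ds)) ⟩
  (last (flatten (D ∷ Ds)) >>= id)                         ≡⟨ last-flatten D Ds ⟩
  (last (D ∷ Ds) >>= last)                                 ∎
  where
  open ≡-Reasoning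
  skipWall : (w : List (Maybe A)) → (last (nothing ∷ w) >>= id) ≡ (last w >>= id)
  skipWall [] = refl
  skipWall (_ ∷ _) = refl

last-split : (w : List (Maybe A)) → (last (toList (split w)) >>= last) ≡ (last w >>= id)
last-split w = sym (begin
  (last w >>= id)                     ≡⟨ cong (λ w → last w >>= id) (sym (flatten-split w)) ⟩
  (last (flatten (split w)) >>= id)   ≡⟨ last-flatten (List⁺.head (split w)) (List⁺.tail (split w)) ⟩
  (last (toList (split w)) >>= last)  ∎)
  where open ≡-Reasoning

walls-map-just : ∀ (C : List A) w → walls (map just C ++ w) ≡ walls w
walls-map-just [] w = refl
walls-map-just (x ∷ C) w = walls-map-just C w

walls-flatten : ∀ (C : List A) Cs → walls (flatten (C ∷ Cs)) ≡ length Cs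
walls-flatten C [] = walls-map-just C []
walls-flatten C (D ∷ Ds) = trans (walls-map-just C _) (cong suc (walls-flatten D Ds))

catMaybes-map-just : ∀ (C : List A) w → catMaybes (map just C ++ w) ≡ C ++ catMaybes w
catMaybes-map-just [] w = refl
catMaybes-map-just (x ∷ C) w = cong (x ∷_) (catMaybes-map-just C w)

catMaybes-flatten : ∀ (C : List A) Cs → catMaybes (flatten (C ∷ Cs)) ≡ concat (C ∷ Cs)
catMaybes-flatten C [] = catMaybes-map-just C []
catMaybes-flatten C (D ∷ Ds) = trans (catMaybes-map-just C _) (cong (C ++_) (catMaybes-flatten D Ds))

module _ {P : Pred A ℓ} (P? : Decidable P) where

  -- The blocks R₁ … Rₘ give the compartments H₁ | L₁H₂ | … | Lₘ, where L and H are the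
  -- longest P-prefix of a block and the rest; the first argument is the pending L.
  compartmentsAfter : List A → List (List A) → List⁺ (List A)
  compartmentsAfter L [] = L ∷ []
  compartmentsAfter L (R ∷ Rs) = (L ++ dropWhile P? R) ∷⁺ compartmentsAfter (takeWhile P? R) Rs

  compartmentsOf : List (List A) → List⁺ (List A)
  compartmentsOf = compartmentsAfter []

  blocksFrom : List A → List (List A) → List (List A)
  blocksFrom prev [] = []
  blocksFrom prev (C ∷ Cs) = (takeWhile P? C ++ dropWhile P? prev) ∷ blocksFrom C Cs

  blocksOf : List⁺ (List A) → List (List A)
  blocksOf (C ∷ Cs) = blocksFrom C Cs

  -- prev is the compartment that holds the part of R beyond its P-prefix.
  blocksFrom-compartmentsAfter : ∀ prev R Rs → dropWhile P? prev ≡ dropWhile P? R →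
    blocksFrom prev (toList (compartmentsAfter (takeWhile P? R) Rs)) ≡ R ∷ Rs
  blocksFrom-compartmentsAfter prev R [] eq = cong (_∷ []) (begin
    takeWhile P? (takeWhile P? R) ++ dropWhile P? prev ≡⟨ cong₂ _++_ (takeWhile-all P? (All-takeWhile P? R)) eq ⟩
    takeWhile P? R ++ dropWhile P? R                  ≡⟨ takeWhile++dropWhile P? R ⟩
    R                                                 ∎)
    where open ≡-Reasoning
  blocksFrom-compartmentsAfter prev R (R′ ∷ Rs) eq =
    cong₂ _∷_ first (blocksFrom-compartmentsAfter (takeWhile P? R ++ dropWhile P? R′) R′ Rs rest)
    where
    open ≡-Reasoning
    first : takeWhile P? (takeWhile P? R ++ dropWhile P? R′) ++ dropWhile P? prev ≡ R
    first = begin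
      takeWhile P? (takeWhile P? R ++ dropWhile P? R′) ++ dropWhile P? prev
        ≡⟨ cong₂ _++_ (takeWhile-++ P? _ (All-takeWhile P? R)) eq ⟩
      (takeWhile P? R ++ takeWhile P? (dropWhile P? R′)) ++ dropWhile P? R
        ≡⟨ cong (λ xs → (takeWhile P? R ++ xs) ++ dropWhile P? R) (takeWhile-dropWhile P? R′) ⟩
      (takeWhile P? R ++ []) ++ dropWhile P? R
        ≡⟨ cong (_++ dropWhile P? R) (++-identityʳ (takeWhile P? R)) ⟩
      takeWhile P? R ++ dropWhile P? R
        ≡⟨ takeWhile++dropWhile P? R ⟩
      R ∎
    rest : dropWhile P? (takeWhile P? R ++ dropWhile P? R′) ≡ dropWhile P? R′
    rest = trans (dropWhile-++ P? _ (All-takeWhile P? R)) (dropWhile-idem P? R′)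

  blocksOf-compartmentsOf : ∀ Rs → blocksOf (compartmentsOf Rs) ≡ Rs
  blocksOf-compartmentsOf [] = refl
  blocksOf-compartmentsOf (R ∷ Rs) = blocksFrom-compartmentsAfter (dropWhile P? R) R Rs (dropWhile-idem P? R)

  compartmentsAfter-blocksFrom : ∀ prev Cs → Maybe.All (All P) (last (prev ∷ Cs)) →
    compartmentsAfter (takeWhile P? prev) (blocksFrom prev Cs) ≡ prev ∷ Cs
  compartmentsAfter-blocksFrom prev [] (Maybe.just allP) = cong (_∷ []) (takeWhile-all P? allP)
  compartmentsAfter-blocksFrom prev (C ∷ Cs) lastP = begin
    (takeWhile P? prev ++ dropWhile P? next) ∷⁺ compartmentsAfter (takeWhile P? next) (blocksFrom C Cs)
      ≡⟨ cong₂ (λ D L → D ∷⁺ compartmentsAfter L (blocksFrom C Cs)) first pending ⟩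
    prev ∷⁺ compartmentsAfter (takeWhile P? C) (blocksFrom C Cs)
      ≡⟨ cong (prev ∷⁺_) (compartmentsAfter-blocksFrom C Cs lastP) ⟩
    prev ∷ C ∷ Cs ∎
    where
    open ≡-Reasoning
    next = takeWhile P? C ++ dropWhile P? prev
    first : takeWhile P? prev ++ dropWhile P? next ≡ prev
    first = trans (cong (takeWhile P? prev ++_)
                        (trans (dropWhile-++ P? _ (All-takeWhile P? C)) (dropWhile-idem P? prev)))
                  (takeWhile++dropWhile P? prev)
    pending : takeWhile P? next ≡ takeWhile P? C
    pending = trans (takeWhile-++ P? _ (All-takeWhile P? C))
                    (trans (cong (takeWhile P? C ++_) (takeWhile-dropWhile P? prev)) (++-identityʳ _))

  compartmentsOf-blocksOf : ∀ C Cs → Maybe.All (∁ P) (head C) → Maybe.All (All P) (last (C ∷ Cs)) →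
    compartmentsOf (blocksOf (C ∷ Cs)) ≡ C ∷ Cs
  compartmentsOf-blocksOf C Cs head∁P lastP =
    trans (cong (λ L → compartmentsAfter L (blocksFrom C Cs)) (sym (takeWhile-∁head P? head∁P)))
          (compartmentsAfter-blocksFrom C Cs lastP)

  length-compartmentsAfter : ∀ L Rs → length (List⁺.tail (compartmentsAfter L Rs)) ≡ length Rs
  length-compartmentsAfter L [] = refl
  length-compartmentsAfter L (R ∷ Rs) = cong suc (length-compartmentsAfter (takeWhile P? R) Rs)

  concat-compartmentsAfter : ∀ L Rs → concat (toList (compartmentsAfter L Rs)) ↭ L ++ concat Rs
  concat-compartmentsAfter L [] = ↭-refl
  concat-compartmentsAfter L (R ∷ Rs) = begin
    (L ++ dropWhile P? R) ++ concat (toList (compartmentsAfter (takeWhile P? R) Rs))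
      ↭⟨ ++⁺ˡ (L ++ dropWhile P? R) (concat-compartmentsAfter (takeWhile P? R) Rs) ⟩
    (L ++ dropWhile P? R) ++ takeWhile P? R ++ concat Rs
      ≡⟨ ++-assoc L (dropWhile P? R) _ ⟩
    L ++ dropWhile P? R ++ takeWhile P? R ++ concat Rs
      ↭⟨ ++⁺ˡ L (shifts (dropWhile P? R) (takeWhile P? R)) ⟩
    L ++ takeWhile P? R ++ dropWhile P? R ++ concat Rs
      ≡⟨ cong (L ++_) (sym (++-assoc (takeWhile P? R) (dropWhile P? R) (concat Rs))) ⟩
    L ++ (takeWhile P? R ++ dropWhile P? R) ++ concat Rs
      ≡⟨ cong (λ xs → L ++ xs ++ concat Rs) (takeWhile++dropWhile P? R) ⟩
    L ++ R ++ concat Rs ∎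
    where open PermutationReasoning

module _ {P : Pred A ℓ} (P? : Decidable P) (Rs : List (List A)) where

  walls-compartmentsOf : walls (flatten (compartmentsOf P? Rs)) ≡ length Rs
  walls-compartmentsOf = trans (walls-flatten (List⁺.head Cs) (List⁺.tail Cs)) (length-compartmentsAfter P? [] Rs)
    where Cs = compartmentsOf P? Rs

  catMaybes-compartmentsOf : catMaybes (flatten (compartmentsOf P? Rs)) ↭ concat Rs
  catMaybes-compartmentsOf =
    subst (_↭ concat Rs) (sym (catMaybes-flatten (List⁺.head Cs) (List⁺.tail Cs))) (concat-compartmentsAfter P? [] Rs)
    where Cs = compartmentsOf P? Rs

module _ (f : A → B) {P : Pred B ℓ} (P? : Decidable P) {Q : Pred A ℓ} (Q? : Decidable Q)
         (agree : ∀ x → does (P? (f x)) ≡ does (Q? x)) where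

  compartmentsAfter-map : ∀ L Rs → compartmentsAfter P? (map f L) (map (map f) Rs)
                                   ≡ List⁺.map (map f) (compartmentsAfter Q? L Rs)
  compartmentsAfter-map L [] = refl
  compartmentsAfter-map L (R ∷ Rs)
    rewrite dropWhile-map f P? Q? agree R | takeWhile-map f P? Q? agree R
          | sym (map-++ f L (dropWhile Q? R)) | compartmentsAfter-map (takeWhile Q? R) Rs = refl

  compartmentsOf-map : ∀ Rs → compartmentsOf P? (map (map f) Rs) ≡ List⁺.map (map f) (compartmentsOf Q? Rs)
  compartmentsOf-map = compartmentsAfter-map []

  blocksFrom-map : ∀ prev Cs → blocksFrom P? (map f prev) (map (map f) Cs) ≡ map (map f) (blocksFrom Q? prev Cs)
  blocksFrom-map prev [] = refl
  blocksFrom-map prev (C ∷ Cs)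
    rewrite takeWhile-map f P? Q? agree C | dropWhile-map f P? Q? agree prev
          | sym (map-++ f (takeWhile Q? C) (dropWhile Q? prev)) | blocksFrom-map C Cs = refl

  blocksOf-map : ∀ Cs → blocksOf P? (List⁺.map (map f) Cs) ≡ map (map f) (blocksOf Q? Cs)
  blocksOf-map (C ∷ Cs) = blocksFrom-map C Cs

Sorted : List ℕ → Set
Sorted = AllPairs _<_

incr⇔Sorted : ∀ {xs} → T (incr xs) ⇔ Sorted xs
incr⇔Sorted = mk⇔ (Linked⇒AllPairs <-trans ∘ toLinked _) (fromLinked ∘ AllPairs⇒Linked)
  where
  toLinked : ∀ xs → T (incr xs) → Linked _<_ xs
  toLinked [] _ = []
  toLinked (x ∷ []) _ = [-]
  toLinked (x ∷ y ∷ xs) t =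
    <ᵇ⇒< x y (proj₁ (T-∧ {x <ᵇ y} .to t)) ∷ toLinked (y ∷ xs) (proj₂ (T-∧ {x <ᵇ y} .to t))
  fromLinked : ∀ {xs} → Linked _<_ xs → T (incr xs)
  fromLinked [] = _
  fromLinked [-] = _
  fromLinked (x<y ∷ rest) = T-∧ .from (<⇒<ᵇ x<y , fromLinked rest)

module _ (u : ℕ) where

  sorted-above-head : ∀ {xs} → Sorted xs → Maybe.All (u <_) (head xs) → All (u <_) xs
  sorted-above-head [] _ = []
  sorted-above-head (x<xs ∷ _) (Maybe.just u<x) = u<x ∷ All.map (<-trans u<x) x<xs

  dropWhile-above : ∀ {xs} → Sorted xs → All (u <_) (dropWhile (_≤? u) xs)
  dropWhile-above {xs} sorted =
    sorted-above-head (AllPairs-dropWhile (_≤? u) sorted) (Maybe.map ≰⇒> (all-head-dropWhile (_≤? u) xs))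

  sorted-++-dropWhile : ∀ {L R} → Sorted L → All (_≤ u) L → Sorted R → Sorted (L ++ dropWhile (_≤? u) R)
  sorted-++-dropWhile sortedL lowL sortedR =
    AllPairs.++⁺ sortedL (AllPairs-dropWhile (_≤? u) sortedR)
      (All.map (λ x≤u → All.map (≤-<-trans x≤u) (dropWhile-above sortedR)) lowL)

  sorted-last : ∀ {xs} → Sorted xs → Maybe.All (_≤ u) (last xs) → All (_≤ u) xs
  sorted-last [] _ = []
  sorted-last {x ∷ []} _ (Maybe.just x≤u) = x≤u ∷ []
  sorted-last {x ∷ y ∷ xs} ((x<y ∷ _) ∷ sorted) lastLow with sorted-last sorted lastLow
  ... | y≤u ∷ rest = <⇒≤ (<-≤-trans x<y y≤u) ∷ y≤u ∷ rest

  -- Conditions (1), (3) and (2) of T* at a vertex labelled u, read on its compartments.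
  record Admissible (Cs : List⁺ (List ℕ)) : Set where
    field
      sorted : All Sorted (toList Cs)
      first  : Maybe.All (u ≤_) (head (List⁺.head Cs))
      final  : Maybe.All (_≤ u) (last (toList Cs) >>= last)

  compartmentsAfter-sorted : ∀ {L} Rs → Sorted L → All (_≤ u) L → All Sorted Rs →
                             All Sorted (toList (compartmentsAfter (_≤? u) L Rs))
  compartmentsAfter-sorted [] sortedL _ [] = sortedL ∷ []
  compartmentsAfter-sorted (R ∷ Rs) sortedL lowL (sortedR ∷ sortedRs) =
    sorted-++-dropWhile sortedL lowL sortedR
      ∷ compartmentsAfter-sorted Rs (AllPairs-takeWhile (_≤? u) sortedR) (All-takeWhile (_≤? u) R) sortedRs

  compartmentsAfter-final : ∀ {L} Rs → All (_≤ u) L → Maybe.All (All (_≤ u)) (last (toList (compartmentsAfter (_≤? u) L Rs)))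
  compartmentsAfter-final [] lowL = Maybe.just lowL
  compartmentsAfter-final (R ∷ Rs) _ = compartmentsAfter-final Rs (All-takeWhile (_≤? u) R)

  compartmentsOf-admissible : ∀ {Rs} → All Sorted Rs → Admissible (compartmentsOf (_≤? u) Rs)
  compartmentsOf-admissible {Rs} sortedRs = record
    { sorted = compartmentsAfter-sorted Rs [] [] sortedRs
    ; first  = first Rs
    ; final  = bind-last⁺ (compartmentsAfter-final Rs [])
    }
    where
    first : ∀ Rs → Maybe.All (u ≤_) (head (List⁺.head (compartmentsOf (_≤? u) Rs)))
    first [] = Maybe.nothing
    first (R ∷ _) = Maybe.map (<⇒≤ ∘ ≰⇒>) (all-head-dropWhile (_≤? u) R)

  blocksFrom-sorted : ∀ {prev} Cs → Sorted prev → All Sorted Cs → All Sorted (blocksFrom (_≤? u) prev Cs)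
  blocksFrom-sorted [] _ [] = []
  blocksFrom-sorted (C ∷ Cs) sortedPrev (sortedC ∷ sortedCs) =
    sorted-++-dropWhile (AllPairs-takeWhile (_≤? u) sortedC) (All-takeWhile (_≤? u) C) sortedPrev
      ∷ blocksFrom-sorted Cs sortedC sortedCs

  blocksOf-sorted : ∀ {Cs} → All Sorted (toList Cs) → All Sorted (blocksOf (_≤? u) Cs)
  blocksOf-sorted {C ∷ Cs} (sortedC ∷ sortedCs) = blocksFrom-sorted Cs sortedC sortedCs

  module _ {Cs : List⁺ (List ℕ)} (adm : Admissible Cs) where
    open Admissible adm

    admissible-head : Maybe.All (_≢ u) (head (List⁺.head Cs)) → Maybe.All (∁ (_≤ u)) (head (List⁺.head Cs))
    admissible-head = head-above first
      where
      head-above : ∀ {m} → Maybe.All (u ≤_) m → Maybe.All (_≢ u) m → Maybe.All (∁ (_≤ u)) m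
      head-above (Maybe.just u≤v) (Maybe.just v≢u) = Maybe.just (<⇒≱ (≤∧≢⇒< u≤v (v≢u ∘ sym)))
      head-above Maybe.nothing _ = Maybe.nothing

    admissible-final : Maybe.All (All (_≤ u)) (last (toList Cs))
    admissible-final = final-low (last⁺ sorted) final
      where
      final-low : ∀ {m} → Maybe.All Sorted m → Maybe.All (_≤ u) (m >>= last) → Maybe.All (All (_≤ u)) m
      final-low (Maybe.just sortedC) lastLow = Maybe.just (sorted-last sortedC lastLow)
      final-low Maybe.nothing _ = Maybe.nothing

labelOf : OddTree → Maybe ℕ
labelOf half = nothing
labelOf (od a _) = just a

childCompartments : List OddTree → List⁺ (List ℕ)
childCompartments cs = split (map labelOf cs)

compartments-childCompartments : ∀ cs → compartments cs ≡ toList (childCompartments cs)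
compartments-childCompartments [] = refl
compartments-childCompartments (half ∷ cs) = cong ([] ∷_) (compartments-childCompartments cs)
compartments-childCompartments (od a _ ∷ cs) rewrite compartments-childCompartments cs = refl

cond3⇔ : ∀ u cs → T (cond3 u cs) ⇔ Maybe.All (u ≤_) (head (List⁺.head (childCompartments cs)))
cond3⇔ u [] = mk⇔ (λ _ → Maybe.nothing) (λ _ → _)
cond3⇔ u (half ∷ cs) = mk⇔ (λ _ → Maybe.nothing) (λ _ → halfFirst)
  where
  halfFirst : T (cond3 u (half ∷ cs))
  halfFirst with head (labeledChildren cs)
  ... | nothing = _
  ... | just v = subst T (sym (∨-zeroʳ (not (v <ᵇ u)))) _
cond3⇔ u (od v _ ∷ cs) = ⇔.trans (T-not-<ᵇ-∨-false v u) Maybe.just-equivalence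

labeledChildren-++ : ∀ xs ys → labeledChildren (xs ++ ys) ≡ labeledChildren xs ++ labeledChildren ys
labeledChildren-++ [] ys = refl
labeledChildren-++ (half ∷ xs) ys = labeledChildren-++ xs ys
labeledChildren-++ (od a _ ∷ xs) ys = cong (a ∷_) (labeledChildren-++ xs ys)

cond2⇔ : ∀ u cs → T (cond2 u cs) ⇔ Maybe.All (_≤ u) (last cs >>= labelOf)
cond2⇔ u cs with initLast cs
... | [] = mk⇔ (λ _ → Maybe.nothing) (λ _ → _)
... | cs′ ∷ʳ′ half rewrite last-++-∷ cs′ half [] = mk⇔ (λ _ → Maybe.nothing) (λ _ → halfLast)
  where
  halfLast : T (cond2 u (cs′ ++ half ∷ []))
  halfLast with last (labeledChildren (cs′ ++ half ∷ []))
  ... | nothing = _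
  ... | just v rewrite reverse-++ cs′ (half ∷ []) = subst T (sym (∨-zeroʳ (not (u <ᵇ v)))) _
... | cs′ ∷ʳ′ od v es
  rewrite last-++-∷ cs′ (od v es) [] | labeledChildren-++ cs′ (od v es ∷ [])
        | last-++-∷ (labeledChildren cs′) v [] | reverse-++ cs′ (od v es ∷ [])
  = ⇔.trans (T-not-<ᵇ-∨-false u v) Maybe.just-equivalence

lastLabel : ∀ cs → (last (toList (childCompartments cs)) >>= last) ≡ (last cs >>= labelOf)
lastLabel cs = begin
  (last (toList (split (map labelOf cs))) >>= last) ≡⟨ last-split (map labelOf cs) ⟩
  (last (map labelOf cs) >>= id)                    ≡⟨ cong (_>>= id) (last-map labelOf cs) ⟩
  (maybeMap labelOf (last cs) >>= id)               ≡⟨ bind-map (last cs) ⟩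
  (last cs >>= labelOf)                             ∎
  where
  open ≡-Reasoning
  bind-map : ∀ m → (maybeMap labelOf m >>= id) ≡ (m >>= labelOf)
  bind-map nothing = refl
  bind-map (just _) = refl

cond1⇔ : ∀ cs → T (cond1 cs) ⇔ All Sorted (toList (childCompartments cs))
cond1⇔ cs rewrite sym (compartments-childCompartments cs) =
  mk⇔ (All.map (incr⇔Sorted .to) ∘ T-all⇔ incr .to)
      (T-all⇔ incr .from ∘ All.map (incr⇔Sorted .from))

vertexConditions⇔ : ∀ u cs {b} → T (cond1 cs ∧ cond2 u cs ∧ cond3 u cs ∧ b)
                                  ⇔ (Admissible u (childCompartments cs) × T b)
vertexConditions⇔ u cs {b} = ⇔.trans (T-∧₄ (cond1 cs) (cond2 u cs) (cond3 u cs)) (mk⇔ admissible conditions)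
  where
  admissible : T (cond1 cs) × T (cond2 u cs) × T (cond3 u cs) × T b → Admissible u (childCompartments cs) × T b
  admissible (c₁ , c₂ , c₃ , tb) = record
    { sorted = cond1⇔ cs .to c₁
    ; first  = cond3⇔ u cs .to c₃
    ; final  = subst (Maybe.All (_≤ u)) (sym (lastLabel cs)) (cond2⇔ u cs .to c₂)
    } , tb
  conditions : Admissible u (childCompartments cs) × T b → T (cond1 cs) × T (cond2 u cs) × T (cond3 u cs) × T b
  conditions (adm , tb) =
    cond1⇔ cs .from sorted , cond2⇔ u cs .from (subst (Maybe.All (_≤ u)) (lastLabel cs) final) ,
    cond3⇔ u cs .from first , tb
    where open Admissible adm

-- The maps ψ and φ

Child : Set
Child = ℕ × List EvenTree

toOdd : Maybe Child → OddTree
toOdd nothing = half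
toOdd (just (a , es)) = od a es

toBlock : List BOdd → Block
toBlock [] = hblock
toBlock (o ∷ os) = lblock (o ∷ os)

lowChild? : ∀ u → Decidable (λ (x : Child) → proj₁ x ≤ u)
lowChild? u x = proj₁ x ≤? u

lowBOdd? : ∀ u → Decidable (λ o → labelBO o ≤ u)
lowBOdd? u o = labelBO o ≤? u

mutual
  ψ : BEven → EvenTree
  ψ (bev u bs) = ev u (map toOdd (flatten (compartmentsOf (lowChild? u) (ψ-blocks bs))))

  ψ-blocks : List Block → List (List Child)
  ψ-blocks [] = []
  ψ-blocks (hblock ∷ bs) = [] ∷ ψ-blocks bs
  ψ-blocks (lblock (o ∷ os) ∷ bs) = (ψ-odd o ∷ ψ-odds os) ∷ ψ-blocks bs

  ψ-odds : List BOdd → List Child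
  ψ-odds [] = []
  ψ-odds (o ∷ os) = ψ-odd o ∷ ψ-odds os

  ψ-odd : BOdd → Child
  ψ-odd (bod a es) = a , ψ-evens es

  ψ-evens : List BEven → List EvenTree
  ψ-evens [] = []
  ψ-evens (e ∷ es) = ψ e ∷ ψ-evens es

mutual
  φ : EvenTree → BEven
  φ (ev u cs) = bev u (map toBlock (blocksOf (lowBOdd? u) (split (φ-children cs))))

  φ-children : List OddTree → List (Maybe BOdd)
  φ-children [] = []
  φ-children (half ∷ cs) = nothing ∷ φ-children cs
  φ-children (od a es ∷ cs) = just (bod a (φ-evens es)) ∷ φ-children cs

  φ-evens : List EvenTree → List BEven
  φ-evens [] = []
  φ-evens (e ∷ es) = φ e ∷ φ-evens es

φ-odd : Child → BOdd
φ-odd (a , es) = bod a (φ-evens es)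

φ-children-toOdd : ∀ w → φ-children (map toOdd w) ≡ map (maybeMap φ-odd) w
φ-children-toOdd [] = refl
φ-children-toOdd (nothing ∷ w) = cong (nothing ∷_) (φ-children-toOdd w)
φ-children-toOdd (just _ ∷ w) = cong (_ ∷_) (φ-children-toOdd w)

ψ-odds≡map : ∀ os → ψ-odds os ≡ map ψ-odd os
ψ-odds≡map [] = refl
ψ-odds≡map (o ∷ os) = cong (ψ-odd o ∷_) (ψ-odds≡map os)

ψ-blocks-toBlock : ∀ Rs → ψ-blocks (map toBlock Rs) ≡ map (map ψ-odd) Rs
ψ-blocks-toBlock [] = refl
ψ-blocks-toBlock ([] ∷ Rs) = cong ([] ∷_) (ψ-blocks-toBlock Rs)
ψ-blocks-toBlock ((o ∷ os) ∷ Rs) = cong₂ (λ os′ Rs′ → (ψ-odd o ∷ os′) ∷ Rs′) (ψ-odds≡map os) (ψ-blocks-toBlock Rs)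

labelOf-toOdd : ∀ w → map labelOf (map toOdd w) ≡ map (maybeMap proj₁) w
labelOf-toOdd [] = refl
labelOf-toOdd (nothing ∷ w) = cong (nothing ∷_) (labelOf-toOdd w)
labelOf-toOdd (just _ ∷ w) = cong (_ ∷_) (labelOf-toOdd w)

labelOf-φ-children : ∀ cs → map labelOf cs ≡ map (maybeMap labelBO) (φ-children cs)
labelOf-φ-children [] = refl
labelOf-φ-children (half ∷ cs) = cong (nothing ∷_) (labelOf-φ-children cs)
labelOf-φ-children (od a _ ∷ cs) = cong (just a ∷_) (labelOf-φ-children cs)

labelsOf-ψ-odds : ∀ os → map proj₁ (ψ-odds os) ≡ labelsOfBOs os
labelsOf-ψ-odds [] = refl
labelsOf-ψ-odds (bod a _ ∷ os) = cong (a ∷_) (labelsOf-ψ-odds os)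

labelsOfBOs≡map : ∀ os → labelsOfBOs os ≡ map labelBO os
labelsOfBOs≡map [] = refl
labelsOfBOs≡map (o ∷ os) = cong (labelBO o ∷_) (labelsOfBOs≡map os)

length-ψ-evens : ∀ es → length (ψ-evens es) ≡ length es
length-ψ-evens [] = refl
length-ψ-evens (e ∷ es) = cong suc (length-ψ-evens es)

length-φ-evens : ∀ es → length (φ-evens es) ≡ length es
length-φ-evens [] = refl
length-φ-evens (e ∷ es) = cong suc (length-φ-evens es)

roots-ψ-evens : ∀ i es → all (λ e → rootLabelE e ≡ᵇ i) (ψ-evens es) ≡ all (λ e → rootLabelBE e ≡ᵇ i) es
roots-ψ-evens i [] = refl
roots-ψ-evens i (bev a _ ∷ es) = cong ((a ≡ᵇ i) ∧_) (roots-ψ-evens i es)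

roots-φ-evens : ∀ i es → all (λ e → rootLabelBE e ≡ᵇ i) (φ-evens es) ≡ all (λ e → rootLabelE e ≡ᵇ i) es
roots-φ-evens i [] = refl
roots-φ-evens i (ev a _ ∷ es) = cong ((a ≡ᵇ i) ∧_) (roots-φ-evens i es)

childCompartments-ψ : ∀ u Rs → childCompartments (map toOdd (flatten (compartmentsOf (lowChild? u) Rs)))
                                ≡ compartmentsOf (_≤? u) (map (map proj₁) Rs)
childCompartments-ψ u Rs = begin
  split (map labelOf (map toOdd (flatten Cs)))   ≡⟨ cong split (labelOf-toOdd (flatten Cs)) ⟩
  split (map (maybeMap proj₁) (flatten Cs))      ≡⟨ split-map proj₁ (flatten Cs) ⟩
  List⁺.map (map proj₁) (split (flatten Cs))     ≡⟨ cong (List⁺.map (map proj₁)) (split-flatten _ _) ⟩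
  List⁺.map (map proj₁) Cs                       ≡⟨ compartmentsOf-map proj₁ (_≤? u) (lowChild? u) (λ _ → refl) Rs ⟨
  compartmentsOf (_≤? u) (map (map proj₁) Rs) ∎
  where
  open ≡-Reasoning
  Cs = compartmentsOf (lowChild? u) Rs

childCompartments-φ : ∀ cs → childCompartments cs ≡ List⁺.map (map labelBO) (split (φ-children cs))
childCompartments-φ cs = trans (cong split (labelOf-φ-children cs)) (split-map labelBO (φ-children cs))

mutual
  φ∘ψ : ∀ t → φ (ψ t) ≡ t
  φ∘ψ (bev u bs) = cong (bev u) (begin
    map toBlock (blocksOf (lowBOdd? u) (split (φ-children (map toOdd (flatten Cs)))))
      ≡⟨ cong (map toBlock ∘ blocksOf (lowBOdd? u) ∘ split) (φ-children-toOdd (flatten Cs)) ⟩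
    map toBlock (blocksOf (lowBOdd? u) (split (map (maybeMap φ-odd) (flatten Cs))))
      ≡⟨ cong (map toBlock ∘ blocksOf (lowBOdd? u)) (split-map φ-odd (flatten Cs)) ⟩
    map toBlock (blocksOf (lowBOdd? u) (List⁺.map (map φ-odd) (split (flatten Cs))))
      ≡⟨ cong (map toBlock ∘ blocksOf (lowBOdd? u) ∘ List⁺.map (map φ-odd)) (split-flatten _ _) ⟩
    map toBlock (blocksOf (lowBOdd? u) (List⁺.map (map φ-odd) Cs))
      ≡⟨ cong (map toBlock) (blocksOf-map φ-odd (lowBOdd? u) (lowChild? u) (λ _ → refl) Cs) ⟩
    map toBlock (map (map φ-odd) (blocksOf (lowChild? u) Cs))
      ≡⟨ cong (map toBlock ∘ map (map φ-odd)) (blocksOf-compartmentsOf (lowChild? u) (ψ-blocks bs)) ⟩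
    map toBlock (map (map φ-odd) (ψ-blocks bs))
      ≡⟨ φ∘ψ-blocks bs ⟩
    bs ∎)
    where
    open ≡-Reasoning
    Cs = compartmentsOf (lowChild? u) (ψ-blocks bs)

  φ∘ψ-blocks : ∀ bs → map toBlock (map (map φ-odd) (ψ-blocks bs)) ≡ bs
  φ∘ψ-blocks [] = refl
  φ∘ψ-blocks (hblock ∷ bs) = cong (hblock ∷_) (φ∘ψ-blocks bs)
  φ∘ψ-blocks (lblock (o ∷ os) ∷ bs) =
    cong₂ (λ R bs′ → toBlock R ∷ bs′) (cong₂ _∷_ (φ∘ψ-odd o) (φ∘ψ-odds os)) (φ∘ψ-blocks bs)

  φ∘ψ-odds : ∀ os → map φ-odd (ψ-odds os) ≡ os
  φ∘ψ-odds [] = refl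
  φ∘ψ-odds (o ∷ os) = cong₂ _∷_ (φ∘ψ-odd o) (φ∘ψ-odds os)

  φ∘ψ-odd : ∀ o → φ-odd (ψ-odd o) ≡ o
  φ∘ψ-odd (bod a es) = cong (bod a) (φ∘ψ-evens es)

  φ∘ψ-evens : ∀ es → φ-evens (ψ-evens es) ≡ es
  φ∘ψ-evens [] = refl
  φ∘ψ-evens (e ∷ es) = cong₂ _∷_ (φ∘ψ e) (φ∘ψ-evens es)

-- Inverting ψ

mutual
  FreshE : EvenTree → Set
  FreshE (ev u cs) = FreshChildren u cs

  FreshChildren : ℕ → List OddTree → Set
  FreshChildren u [] = ⊤
  FreshChildren u (half ∷ cs) = FreshChildren u cs
  FreshChildren u (od v es ∷ cs) = v ≢ u × FreshEs es × FreshChildren u cs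

  FreshEs : List EvenTree → Set
  FreshEs [] = ⊤
  FreshEs (e ∷ es) = FreshE e × FreshEs es

fresh-first : ∀ u cs → FreshChildren u cs → Maybe.All (_≢ u) (head (List⁺.head (childCompartments cs)))
fresh-first u [] _ = Maybe.nothing
fresh-first u (half ∷ cs) _ = Maybe.nothing
fresh-first u (od v _ ∷ cs) (v≢u , _) = Maybe.just v≢u

module _ (u : ℕ) (cs : List OddTree) (admissible : Admissible u (childCompartments cs))
         (fresh : FreshChildren u cs) where
  private
    W = split (φ-children cs)
    admissibleW : Admissible u (List⁺.map (map labelBO) W)
    admissibleW = subst (Admissible u) (childCompartments-φ cs) admissible

  compartmentsOf-φ-blocks : compartmentsOf (lowBOdd? u) (blocksOf (lowBOdd? u) W) ≡ W
  compartmentsOf-φ-blocks = compartmentsOf-blocksOf (lowBOdd? u) (List⁺.head W) (List⁺.tail W) headHigh finalLow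
    where
    headHigh : Maybe.All (∁ (λ o → labelBO o ≤ u)) (head (List⁺.head W))
    headHigh = head-map⁻ (List⁺.head W) (admissible-head u admissibleW
      (subst (λ Cs → Maybe.All (_≢ u) (head (List⁺.head Cs))) (childCompartments-φ cs) (fresh-first u cs fresh)))
    finalLow : Maybe.All (All (λ o → labelBO o ≤ u)) (last (toList W))
    finalLow = last-map⁻ (toList W) (admissible-final u admissibleW)

  φ-blocks-sorted : All Sorted (map (map labelBO) (blocksOf (lowBOdd? u) W))
  φ-blocks-sorted = subst (All Sorted) (blocksOf-map labelBO (_≤? u) (lowBOdd? u) (λ _ → refl) W)
                          (blocksOf-sorted u (Admissible.sorted admissibleW))

  φ-blocks-↭ : concat (blocksOf (lowBOdd? u) W) ↭ catMaybes (φ-children cs)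
  φ-blocks-↭ = begin
    concat (blocksOf (lowBOdd? u) W)                                   ↭⟨ concat-compartmentsAfter (lowBOdd? u) [] (blocksOf (lowBOdd? u) W) ⟨
    concat (toList (compartmentsOf (lowBOdd? u) (blocksOf (lowBOdd? u) W))) ≡⟨ cong (concat ∘ toList) compartmentsOf-φ-blocks ⟩
    concat (toList W)                                                  ≡⟨ catMaybes-flatten (List⁺.head W) (List⁺.tail W) ⟨
    catMaybes (flatten W)                                              ≡⟨ cong catMaybes (flatten-split (φ-children cs)) ⟩
    catMaybes (φ-children cs)                                          ∎
    where open PermutationReasoning

module _ {n} (k : Vec ℕ n) where

  ChildOk : Child → Set
  ChildOk (i , es) = T (length es ≡ᵇ (mult k i ∸ 1)) × T (all (λ e → rootLabelE e ≡ᵇ i) es) × T (starOkEs k es)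

  mutual
    ψ∘φ : ∀ t → T (starOkE k t) → FreshE t → ψ (φ t) ≡ t
    ψ∘φ (ev u cs) ok fresh = cong (ev u) (begin
      map toOdd (flatten (compartmentsOf (lowChild? u) (ψ-blocks (map toBlock (blocksOf (lowBOdd? u) W)))))
        ≡⟨ cong (map toOdd ∘ flatten ∘ compartmentsOf (lowChild? u)) (ψ-blocks-toBlock (blocksOf (lowBOdd? u) W)) ⟩
      map toOdd (flatten (compartmentsOf (lowChild? u) (map (map ψ-odd) (blocksOf (lowBOdd? u) W))))
        ≡⟨ cong (map toOdd ∘ flatten) (compartmentsOf-map ψ-odd (lowChild? u) (lowBOdd? u) agree (blocksOf (lowBOdd? u) W)) ⟩
      map toOdd (flatten (List⁺.map (map ψ-odd) (compartmentsOf (lowBOdd? u) (blocksOf (lowBOdd? u) W))))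
        ≡⟨ cong (map toOdd ∘ flatten ∘ List⁺.map (map ψ-odd))
                (compartmentsOf-φ-blocks u cs (proj₁ conditions) fresh) ⟩
      map toOdd (flatten (List⁺.map (map ψ-odd) W))
        ≡⟨ cong (map toOdd) (sym (flatten-map ψ-odd (List⁺.head W) (List⁺.tail W))) ⟩
      map toOdd (map (maybeMap ψ-odd) (flatten W))
        ≡⟨ cong (map toOdd ∘ map (maybeMap ψ-odd)) (flatten-split (φ-children cs)) ⟩
      map toOdd (map (maybeMap ψ-odd) (φ-children cs))
        ≡⟨ ψ∘φ-children u cs (proj₂ conditions) fresh ⟩
      cs ∎)
      where
      open ≡-Reasoning
      W = split (φ-children cs)
      agree : ∀ o → does (lowChild? u (ψ-odd o)) ≡ does (lowBOdd? u o)
      agree (bod a es) = refl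
      conditions = vertexConditions⇔ u cs .to ok

    ψ∘φ-children : ∀ u cs → T (starOkOs k cs) → FreshChildren u cs →
                   map toOdd (map (maybeMap ψ-odd) (φ-children cs)) ≡ cs
    ψ∘φ-children u [] _ _ = refl
    ψ∘φ-children u (half ∷ cs) ok fresh = cong (half ∷_) (ψ∘φ-children u cs ok fresh)
    ψ∘φ-children u (od a es ∷ cs) ok (_ , freshEs , fresh)
      with T-∧₄ (length es ≡ᵇ (mult k a ∸ 1)) (all (λ e → rootLabelE e ≡ᵇ a) es) (starOkEs k es) .to ok
    ... | _ , _ , okEs , okRest =
      cong₂ (λ es′ cs′ → od a es′ ∷ cs′) (ψ∘φ-evens es okEs freshEs) (ψ∘φ-children u cs okRest fresh)

    ψ∘φ-evens : ∀ es → T (starOkEs k es) → FreshEs es → ψ-evens (φ-evens es) ≡ es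
    ψ∘φ-evens [] _ _ = refl
    ψ∘φ-evens (e ∷ es) ok (freshE , freshEs) =
      cong₂ _∷_ (ψ∘φ e (proj₁ oks) freshE) (ψ∘φ-evens es (proj₂ oks) freshEs)
      where oks = T-∧ {starOkE k e} .to ok

  starOkOs-toOdd : ∀ w → All ChildOk (catMaybes w) → T (starOkOs k (map toOdd w))
  starOkOs-toOdd [] _ = _
  starOkOs-toOdd (nothing ∷ w) oks = starOkOs-toOdd w oks
  starOkOs-toOdd (just (a , es) ∷ w) ((lengthOk , rootsOk , subtreesOk) ∷ oks) =
    T-∧₄ _ _ _ .from (lengthOk , rootsOk , subtreesOk , starOkOs-toOdd w oks)

  ψ-blocks-sorted : ∀ bs → T (btOkBs k bs) → All Sorted (map (map proj₁) (ψ-blocks bs))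
  ψ-blocks-sorted [] _ = []
  ψ-blocks-sorted (hblock ∷ bs) ok = [] ∷ ψ-blocks-sorted bs ok
  ψ-blocks-sorted (lblock (o ∷ os) ∷ bs) ok with T-∧₄ (incr (labelBO o ∷ labelsOfBOs os)) (btOkO k o) (btOkOs k os) .to ok
  ... | sorted , _ , _ , okRest =
    subst Sorted (sym (labelsOf-ψ-odds (o ∷ os))) (incr⇔Sorted .to sorted) ∷ ψ-blocks-sorted bs okRest

  mutual
    ψ-starOk : ∀ t → T (btOkE k t) → T (starOkE k (ψ t))
    ψ-starOk (bev u bs) ok = vertexConditions⇔ u (map toOdd (flatten Cs)) .from (admissible , childrenOk)
      where
      Cs = compartmentsOf (lowChild? u) (ψ-blocks bs)
      admissible = subst (Admissible u) (sym (childCompartments-ψ u (ψ-blocks bs)))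
                         (compartmentsOf-admissible u (ψ-blocks-sorted bs ok))
      childrenOk = starOkOs-toOdd (flatten Cs)
                     (All-resp-↭ (↭-sym (catMaybes-compartmentsOf (lowChild? u) (ψ-blocks bs))) (ψ-blocks-ok bs ok))

    ψ-blocks-ok : ∀ bs → T (btOkBs k bs) → All ChildOk (concat (ψ-blocks bs))
    ψ-blocks-ok [] _ = []
    ψ-blocks-ok (hblock ∷ bs) ok = ψ-blocks-ok bs ok
    ψ-blocks-ok (lblock (o ∷ os) ∷ bs) ok with T-∧₄ (incr (labelBO o ∷ labelsOfBOs os)) (btOkO k o) (btOkOs k os) .to ok
    ... | _ , okO , okOs , okRest = ψ-odd-ok o okO ∷ All.++⁺ (ψ-odds-ok os okOs) (ψ-blocks-ok bs okRest)

    ψ-odds-ok : ∀ os → T (btOkOs k os) → All ChildOk (ψ-odds os)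
    ψ-odds-ok [] _ = []
    ψ-odds-ok (o ∷ os) ok = ψ-odd-ok o (proj₁ oks) ∷ ψ-odds-ok os (proj₂ oks)
      where oks = T-∧ {btOkO k o} .to ok

    ψ-odd-ok : ∀ o → T (btOkO k o) → ChildOk (ψ-odd o)
    ψ-odd-ok (bod i es) ok rewrite length-ψ-evens es | roots-ψ-evens i es
      with T-∧ {length es ≡ᵇ (mult k i ∸ 1)} .to ok
    ... | lengthOk , ok′ with T-∧ {all (λ e → rootLabelBE e ≡ᵇ i) es} .to ok′
    ... | rootsOk , subtreesOk = lengthOk , rootsOk , ψ-evens-ok es subtreesOk

    ψ-evens-ok : ∀ es → T (btOkEs k es) → T (starOkEs k (ψ-evens es))
    ψ-evens-ok [] _ = _
    ψ-evens-ok (e ∷ es) ok = T-∧ .from (ψ-starOk e (proj₁ oks) , ψ-evens-ok es (proj₂ oks))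
      where oks = T-∧ {btOkE k e} .to ok

  btOkOs-all : ∀ {os} → All (T ∘ btOkO k) os → T (btOkOs k os)
  btOkOs-all [] = _
  btOkOs-all (ok ∷ oks) = T-∧ .from (ok , btOkOs-all oks)

  btOkBs-toBlock : ∀ B → All Sorted (map (map labelBO) B) → All (T ∘ btOkO k) (concat B) → T (btOkBs k (map toBlock B))
  btOkBs-toBlock [] _ _ = _
  btOkBs-toBlock ([] ∷ B) (_ ∷ sorted) oks = btOkBs-toBlock B sorted oks
  btOkBs-toBlock ((o ∷ os) ∷ B) (sortedR ∷ sorted) (okO ∷ oks) = T-∧₄ _ _ _ .from
    ( incr⇔Sorted .from (subst (Sorted ∘ (labelBO o ∷_)) (sym (labelsOfBOs≡map os)) sortedR)
    , okO , btOkOs-all (All.++⁻ˡ os oks) , btOkBs-toBlock B sorted (All.++⁻ʳ os oks) )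

  mutual
    φ-btOk : ∀ t → T (starOkE k t) → FreshE t → T (btOkE k (φ t))
    φ-btOk (ev u cs) ok fresh =
      btOkBs-toBlock _ (φ-blocks-sorted u cs admissible fresh)
        (All-resp-↭ (↭-sym (φ-blocks-↭ u cs admissible fresh)) (φ-children-ok u cs okChildren fresh))
      where
      conditions = vertexConditions⇔ u cs .to ok
      admissible = proj₁ conditions
      okChildren = proj₂ conditions

    φ-children-ok : ∀ u cs → T (starOkOs k cs) → FreshChildren u cs → All (T ∘ btOkO k) (catMaybes (φ-children cs))
    φ-children-ok u [] _ _ = []
    φ-children-ok u (half ∷ cs) ok fresh = φ-children-ok u cs ok fresh
    φ-children-ok u (od i es ∷ cs) ok (_ , freshEs , fresh)
      with T-∧₄ (length es ≡ᵇ (mult k i ∸ 1)) (all (λ e → rootLabelE e ≡ᵇ i) es) (starOkEs k es) .to ok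
    ... | lengthOk , rootsOk , subtreesOk , okRest =
      T-∧ .from
        ( subst (λ l → T (l ≡ᵇ (mult k i ∸ 1))) (sym (length-φ-evens es)) lengthOk
        , T-∧ .from (subst T (sym (roots-φ-evens i es)) rootsOk , φ-evens-ok es subtreesOk freshEs) )
      ∷ φ-children-ok u cs okRest fresh

    φ-evens-ok : ∀ es → T (starOkEs k es) → FreshEs es → T (btOkEs k (φ-evens es))
    φ-evens-ok [] _ _ = _
    φ-evens-ok (e ∷ es) ok (freshE , freshEs) =
      T-∧ .from (φ-btOk e (proj₁ oks) freshE , φ-evens-ok es (proj₂ oks) freshEs)
      where oks = T-∧ {starOkE k e} .to ok

childLabels : Child → List ℕ
childLabels (a , es) = a ∷ labelsEs es

labelsOs-toOdd : ∀ w → labelsOs (map toOdd w) ≡ concatMap childLabels (catMaybes w)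
labelsOs-toOdd [] = refl
labelsOs-toOdd (nothing ∷ w) = labelsOs-toOdd w
labelsOs-toOdd (just (a , es) ∷ w) = cong (λ xs → a ∷ labelsEs es ++ xs) (labelsOs-toOdd w)

mutual
  labels-ψ : ∀ t → labelsE (ψ t) ↭ labelsBE t
  labels-ψ (bev u bs) = prep u (begin
    labelsOs (map toOdd (flatten Cs))               ≡⟨ labelsOs-toOdd (flatten Cs) ⟩
    concatMap childLabels (catMaybes (flatten Cs))  ↭⟨ concat-↭ (map⁺ childLabels (catMaybes-compartmentsOf (lowChild? u) (ψ-blocks bs))) ⟩
    concatMap childLabels (concat (ψ-blocks bs))    ↭⟨ labels-ψ-blocks bs ⟩
    labelsBs bs                                     ∎)
    where
    open PermutationReasoning
    Cs = compartmentsOf (lowChild? u) (ψ-blocks bs)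

  labels-ψ-blocks : ∀ bs → concatMap childLabels (concat (ψ-blocks bs)) ↭ labelsBs bs
  labels-ψ-blocks [] = ↭-refl
  labels-ψ-blocks (hblock ∷ bs) = labels-ψ-blocks bs
  labels-ψ-blocks (lblock (o ∷ os) ∷ bs) rewrite concatMap-++ childLabels (ψ-odds os) (concat (ψ-blocks bs)) =
    ++⁺ (labels-ψ-odd o) (++⁺ (labels-ψ-odds os) (labels-ψ-blocks bs))

  labels-ψ-odds : ∀ os → concatMap childLabels (ψ-odds os) ↭ labelsBOs os
  labels-ψ-odds [] = ↭-refl
  labels-ψ-odds (o ∷ os) = ++⁺ (labels-ψ-odd o) (labels-ψ-odds os)

  labels-ψ-odd : ∀ o → childLabels (ψ-odd o) ↭ labelsBO o
  labels-ψ-odd (bod a es) = prep a (labels-ψ-evens es)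

  labels-ψ-evens : ∀ es → labelsEs (ψ-evens es) ↭ labelsBEs es
  labels-ψ-evens [] = ↭-refl
  labels-ψ-evens (e ∷ es) = ++⁺ (labels-ψ e) (labels-ψ-evens es)

childHalves : Child → ℕ
childHalves (_ , es) = halvesEs es

halvesOs-toOdd : ∀ w → halvesOs (map toOdd w) ≡ sum (map childHalves (catMaybes w)) + walls w
halvesOs-toOdd [] = refl
halvesOs-toOdd (nothing ∷ w) = trans (cong suc (halvesOs-toOdd w)) (sym (+-suc _ (walls w)))
halvesOs-toOdd (just (a , es) ∷ w) = trans (cong (halvesEs es +_) (halvesOs-toOdd w)) (sym (+-assoc (halvesEs es) _ (walls w)))

length-ψ-blocks : ∀ bs → length (ψ-blocks bs) ≡ length bs
length-ψ-blocks [] = refl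
length-ψ-blocks (hblock ∷ bs) = cong suc (length-ψ-blocks bs)
length-ψ-blocks (lblock (_ ∷ _) ∷ bs) = cong suc (length-ψ-blocks bs)

mutual
  halves-ψ : ∀ t → halvesE (ψ t) ≡ blocksBE t
  halves-ψ (bev u bs) = begin
    halvesOs (map toOdd (flatten Cs))
      ≡⟨ halvesOs-toOdd (flatten Cs) ⟩
    sum (map childHalves (catMaybes (flatten Cs))) + walls (flatten Cs)
      ≡⟨ cong₂ _+_ (sum-↭ (map⁺ childHalves (catMaybes-compartmentsOf (lowChild? u) (ψ-blocks bs))))
                   (walls-compartmentsOf (lowChild? u) (ψ-blocks bs)) ⟩
    sum (map childHalves (concat (ψ-blocks bs))) + length (ψ-blocks bs)
      ≡⟨ cong₂ _+_ (halves-ψ-blocks bs) (length-ψ-blocks bs) ⟩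
    blocksBs bs + length bs
      ≡⟨ +-comm (blocksBs bs) (length bs) ⟩
    length bs + blocksBs bs ∎
    where
    open ≡-Reasoning
    Cs = compartmentsOf (lowChild? u) (ψ-blocks bs)

  halves-ψ-blocks : ∀ bs → sum (map childHalves (concat (ψ-blocks bs))) ≡ blocksBs bs
  halves-ψ-blocks [] = refl
  halves-ψ-blocks (hblock ∷ bs) = halves-ψ-blocks bs
  halves-ψ-blocks (lblock (o ∷ os) ∷ bs)
    rewrite map-++ childHalves (ψ-odds os) (concat (ψ-blocks bs))
          | sum-++ (map childHalves (ψ-odds os)) (map childHalves (concat (ψ-blocks bs))) =
    cong₂ _+_ (halves-ψ-odd o) (cong₂ _+_ (halves-ψ-odds os) (halves-ψ-blocks bs))

  halves-ψ-odds : ∀ os → sum (map childHalves (ψ-odds os)) ≡ blocksBOs os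
  halves-ψ-odds [] = refl
  halves-ψ-odds (o ∷ os) = cong₂ _+_ (halves-ψ-odd o) (halves-ψ-odds os)

  halves-ψ-odd : ∀ o → childHalves (ψ-odd o) ≡ blocksBO o
  halves-ψ-odd (bod _ es) = halves-ψ-evens es

  halves-ψ-evens : ∀ es → halvesEs (ψ-evens es) ≡ blocksBEs es
  halves-ψ-evens [] = refl
  halves-ψ-evens (e ∷ es) = cong₂ _+_ (halves-ψ e) (halves-ψ-evens es)

countL≡sum : ∀ ℓ xs → countL ℓ xs ≡ sum (map (λ x → if x ≡ᵇ ℓ then 1 else 0) xs)
countL≡sum ℓ [] = refl
countL≡sum ℓ (x ∷ xs) = cong (_ +_) (countL≡sum ℓ xs)

countL-↭ : ∀ ℓ {xs ys} → xs ↭ ys → countL ℓ xs ≡ countL ℓ ys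
countL-↭ ℓ {xs} {ys} p = trans (countL≡sum ℓ xs) (trans (sum-↭ (map⁺ _ p)) (sym (countL≡sum ℓ ys)))

countL-++ : ∀ ℓ xs ys → countL ℓ (xs ++ ys) ≡ countL ℓ xs + countL ℓ ys
countL-++ ℓ [] ys = refl
countL-++ ℓ (x ∷ xs) ys =
  trans (cong (_ +_) (countL-++ ℓ xs ys)) (sym (+-assoc (if x ≡ᵇ ℓ then 1 else 0) (countL ℓ xs) (countL ℓ ys)))

countL-self : ∀ ℓ xs → countL ℓ (ℓ ∷ xs) ≡ suc (countL ℓ xs)
countL-self ℓ xs rewrite T-≡ .to (≡⇒≡ᵇ ℓ ℓ refl) = refl

countL-absent : ∀ ℓ {xs} → All (_≢ ℓ) xs → countL ℓ xs ≡ 0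
countL-absent ℓ [] = refl
countL-absent ℓ {x ∷ _} (x≢ℓ ∷ rest) with x ≡ᵇ ℓ in eq
... | true = ⊥-elim (x≢ℓ (≡ᵇ⇒≡ x ℓ (subst T (sym eq) _)))
... | false = countL-absent ℓ rest

share-budget : ∀ {a b n} → a + b ≤ suc n → 1 ≤ a → n ≤ b → a ≤ 1 × b ≤ n
share-budget {a} {b} {n} a+b≤1+n 1≤a n≤b =
  +-cancelʳ-≤ n a 1 (≤-trans (+-monoʳ-≤ a n≤b) a+b≤1+n) ,
  ≤-pred (≤-trans (+-monoˡ-≤ b 1≤a) a+b≤1+n)

root-counted : ∀ {i} e → rootLabelE e ≡ i → 1 ≤ countL i (labelsE e)
root-counted (ev a cs) refl rewrite countL-self a (labelsOs cs) = s≤s z≤n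

module _ {n} (k : Vec ℕ n) where

  isMultiset-↭ : ∀ {xs ys} → xs ↭ ys → T (isMultiset k xs) → T (isMultiset k ys)
  isMultiset-↭ {xs} {ys} p ms with T-∧ {all (λ x → x ≤ᵇ n) xs} .to ms
  ... | bounded , counts = T-∧ .from
    ( T-all⇔ (λ x → x ≤ᵇ n) .from
        (All-resp-↭ p (T-all⇔ (λ x → x ≤ᵇ n) .to bounded))
    , T-all⇔ (λ ℓ → countL ℓ ys ≡ᵇ mult k ℓ) {upTo (suc n)} .from
        (All.map (λ {ℓ} → subst (λ c → T (c ≡ᵇ mult k ℓ)) (countL-↭ ℓ p))
                 (T-all⇔ (λ ℓ → countL ℓ xs ≡ᵇ mult k ℓ) {upTo (suc n)} .to counts)) )

  Bounded : List ℕ → Set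
  Bounded xs = ∀ ℓ → countL ℓ xs ≤ mult k ℓ

  isMultiset⇒Bounded : ∀ {xs} → T (isMultiset k xs) → Bounded xs
  isMultiset⇒Bounded {xs} ms ℓ with T-∧ {all (λ x → x ≤ᵇ n) xs} .to ms | ℓ ≤? n
  ... | _ , counts | yes ℓ≤n =
    ≤-reflexive (≡ᵇ⇒≡ _ _ (All.lookup (T-all⇔ (λ ℓ → countL ℓ xs ≡ᵇ mult k ℓ) {upTo (suc n)} .to counts) (∈-upTo⁺ (s≤s ℓ≤n))))
  ... | labelsBounded , _ | no ℓ≰n = ≤-reflexive-0 (countL-absent ℓ (All.map below (T-all⇔ (λ x → x ≤ᵇ n) {xs} .to labelsBounded)))
    where
    below : ∀ {x} → T (x ≤ᵇ n) → x ≢ ℓ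
    below {x} x≤n refl = ℓ≰n (≤ᵇ⇒≤ x n x≤n)
    ≤-reflexive-0 : ∀ {c} → c ≡ 0 → c ≤ mult k ℓ
    ≤-reflexive-0 refl = z≤n

  Bounded-++ : ∀ xs {ys} → Bounded (xs ++ ys) → Bounded xs × Bounded ys
  Bounded-++ xs {ys} bounded = (λ ℓ → m+n≤o⇒m≤o _ (counts ℓ)) , (λ ℓ → m+n≤o⇒n≤o _ (counts ℓ))
    where
    counts : ∀ ℓ → countL ℓ xs + countL ℓ ys ≤ mult k ℓ
    counts ℓ = subst (_≤ mult k ℓ) (countL-++ ℓ xs ys) (bounded ℓ)

  count-roots : ∀ i es → T (all (λ e → rootLabelE e ≡ᵇ i) es) → length es ≤ countL i (labelsEs es)
  count-roots i [] _ = z≤n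
  count-roots i (ev a cs ∷ es) roots with T-∧ {a ≡ᵇ i} .to roots
  ... | a≡i , rest rewrite ≡ᵇ⇒≡ a i a≡i | countL-++ i (i ∷ labelsOs cs) (labelsEs es) | countL-self i (labelsOs cs) =
    s≤s (≤-trans (count-roots i es rest) (m≤n+m _ _))

  -- An even vertex labelled i sees i only once in its subtree: the other kᵢ − 1 copies
  -- sit at its parent and its siblings.
  mutual
    freshE : ∀ e → T (starOkE k e) → Bounded (labelsE e) → countL (rootLabelE e) (labelsE e) ≤ 1 → FreshE e
    freshE (ev u cs) ok bounded single =
      freshChildren u cs (proj₂ (vertexConditions⇔ u cs .to ok)) (proj₂ (Bounded-++ (u ∷ []) {labelsOs cs} bounded))
        (n≤0⇒n≡0 (≤-pred (subst (_≤ 1) (countL-self u (labelsOs cs)) single)))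

    freshChildren : ∀ u cs → T (starOkOs k cs) → Bounded (labelsOs cs) → countL u (labelsOs cs) ≡ 0 →
                    FreshChildren u cs
    freshChildren u [] _ _ _ = _
    freshChildren u (half ∷ cs) ok bounded none = freshChildren u cs ok bounded none
    freshChildren u (od v es ∷ cs) ok bounded none
      with T-∧₄ (length es ≡ᵇ (mult k v ∸ 1)) (all (λ e → rootLabelE e ≡ᵇ v) es) (starOkEs k es) .to ok
    ... | lengthOk , rootsOk , subtreesOk , okRest = v≢u , freshEvens v es subtreesOk rootsOk boundedEs budget ,
                                                     freshChildren u cs okRest boundedRest noneRest
      where
      counts = countL-++ u (v ∷ labelsEs es) (labelsOs cs)
      boundedV = proj₁ (Bounded-++ (v ∷ labelsEs es) {labelsOs cs} bounded)
      boundedEs = proj₂ (Bounded-++ (v ∷ []) {labelsEs es} boundedV)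
      boundedRest = proj₂ (Bounded-++ (v ∷ labelsEs es) {labelsOs cs} bounded)
      noneRest = m+n≡0⇒n≡0 (countL u (v ∷ labelsEs es)) (trans (sym counts) none)
      v≢u : v ≢ u
      v≢u refl with () ← trans (sym (countL-self v (labelsEs es))) (m+n≡0⇒m≡0 _ (trans (sym counts) none))
      budget : countL v (labelsEs es) ≤ length es
      budget = subst (countL v (labelsEs es) ≤_) (sym (≡ᵇ⇒≡ _ _ lengthOk))
                 (∸-monoˡ-≤ 1 (subst (_≤ mult k v) (countL-self v (labelsEs es)) (boundedV v)))

    freshEvens : ∀ i es → T (starOkEs k es) → T (all (λ e → rootLabelE e ≡ᵇ i) es) → Bounded (labelsEs es) →
                 countL i (labelsEs es) ≤ length es → FreshEs es
    freshEvens i [] _ _ _ _ = _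
    freshEvens i (e ∷ es) ok roots bounded budget with T-∧ {starOkE k e} .to ok
                                                      | T-∧ {rootLabelE e ≡ᵇ i} .to roots
    ... | okE , okEs | rootE , rootsEs with share-budget counts (root-counted e (≡ᵇ⇒≡ _ _ rootE)) (count-roots i es rootsEs)
      where
      counts = subst (_≤ suc (length es)) (countL-++ i (labelsE e) (labelsEs es)) budget
    ... | singleE , budgetEs =
      freshE e okE (proj₁ (Bounded-++ (labelsE e) bounded))
        (subst (λ r → countL r (labelsE e) ≤ 1) (sym (≡ᵇ⇒≡ _ _ rootE)) singleE) ,
      freshEvens i es okEs rootsEs (proj₂ (Bounded-++ (labelsE e) bounded)) budgetEs

module _ {n} (k : Vec ℕ n) (m : ℕ) where

  fresh : ∀ t → T (isTStar k m t) → FreshE t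
  fresh t@(ev u cs) valid
    with T-∧₄ (u ≡ᵇ 0) (isMultiset k (labelsE t)) (halvesE t ≡ᵇ m) .to valid
  ... | root , multiset , _ , ok = freshE k t ok bounded
    (subst (λ r → countL r (labelsE t) ≤ 1) (sym (≡ᵇ⇒≡ u 0 root)) (bounded 0))
    where bounded = isMultiset⇒Bounded k {labelsE t} multiset

  ψ∘φ-valid : ∀ t → T (isTStar k m t) → ψ (φ t) ≡ t
  ψ∘φ-valid t valid = ψ∘φ k t ok (fresh t valid)
    where
    ok = proj₂ (proj₂ (proj₂ (T-∧₄ (rootLabelE t ≡ᵇ 0) (isMultiset k (labelsE t)) (halvesE t ≡ᵇ m) .to valid)))

  ψ-valid : ∀ t → T (isBT k m t) → T (isTStar k m (ψ t))
  ψ-valid t@(bev u bs) valid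
    with T-∧₄ (u ≡ᵇ 0) (isMultiset k (labelsBE t)) (blocksBE t ≡ᵇ m) .to valid
  ... | root , multiset , blocks , ok = T-∧₄ _ _ _ .from
    ( root
    , isMultiset-↭ k (↭-sym (labels-ψ t)) multiset
    , subst (λ h → T (h ≡ᵇ m)) (sym (halves-ψ t)) blocks
    , ψ-starOk k t ok )

  φ-valid : ∀ t → T (isTStar k m t) → T (isBT k m (φ t))
  φ-valid t@(ev u cs) valid
    with T-∧₄ (u ≡ᵇ 0) (isMultiset k (labelsE t)) (halvesE t ≡ᵇ m) .to valid
  ... | root , multiset , halves , ok = T-∧₄ _ _ _ .from
    ( root
    , isMultiset-↭ k (subst (_↭ labelsBE (φ t)) (cong labelsE ψφt≡t) (labels-ψ (φ t))) multiset
    , subst (λ h → T (h ≡ᵇ m)) (trans (cong halvesE (sym ψφt≡t)) (halves-ψ (φ t))) halves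
    , φ-btOk k t ok (fresh t valid) )
    where
    ψφt≡t = ψ∘φ-valid t valid

theorem2p2 : (n : ℕ) → 1 ≤ n → (k : Vec ℕ n) → ((i : Fin n) → 1 ≤ lookup k i)
    → (m : ℕ) → BT k m ⤖ TStar k m
theorem2p2 n _ k _ m = ↔⇒⤖ (mk↔ₛ′
  (λ (t , valid) → ψ t , ψ-valid k m t valid)
  (λ (t , valid) → φ t , φ-valid k m t valid)
  (λ (t , valid) → Σ-T-≡ (ψ∘φ-valid k m t valid))
  (λ (t , _) → Σ-T-≡ (φ∘ψ t)))
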